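{- Let $\mathcal{T}$ be a tanglegram having exactly one cross-responsible set $X$, with $\mathcal{T}[X]$ isomorphic to $\mathcal{K}_2$, and label the edges of $\mathcal{T}[X]$ by the standardized labeling of $\mathcal{K}_2$. For $j\in\{1,2\}$ let $M_j$ be the set of edges in $\sigma_{\mathcal{T}}\setminus X$ that have a scar on $d_j$ in $\mathcal{T}[X]$. Then at most one of $M_1$, $M_2$ is non-empty.
   Context: A rooted tree is a tree with at least two vertices and a designated root of degree $1$; leaves are non-root vertices of degree $1$; a rooted binary tree is a rooted tree in which all non-root, non-leaf vertices have degree $3$. For a set $S$ of leaves of a rooted binary tree $T$, $T\llbracket S\rrbracket$ is the union of the root-to-$s$ paths for $s\in S$, and $T[S]$ is obtained from $T\llbracket S\rrbracket$ by suppressing degree-$2$ vertices; each edge $e$ of $T[S]$ corresponds to a path $P_e$ of $T\llbracket S\rrbracket$. For a leaf $w\notin S$, the scar of $w$ in $T[S]$ is on edge $e$ if the first vertex of $T\llbracket S\rrbracket$ met by the path from $w$ to the root is an interior vertex of $P_e$. A tanglegram $\mathcal{T}=(L_{\mathcal{T}},R_{\mathcal{T}},\sigma_{\mathcal{T}})$ consists of two rooted binary trees with equally many leaves and a perfect matching $\sigma_{\mathcal{T}}$ between their leaf sets. For $Z\subseteq\sigma_{\mathcal{T}}$, $\mathcal{T}[Z]$ has left tree $L_{\mathcal{T}}[S_1]$, right tree $R_{\mathcal{T}}[S_2]$ and matching $Z$, where $S_1,S_2$ are the left and right leaves covered by $Z$. Tanglegrams are isomorphic if there is a graph isomorphism mapping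 left root to left root and right root to right root. For $m\in\sigma_{\mathcal{T}}\setminus Z$ with left endpoint $\mu_1$ and right endpoint $\mu_2$, its left-scar in $\mathcal{T}[Z]$ is the scar of $\mu_1$ in $L_{\mathcal{T}}[S_1]$ and its right-scar is the scar of $\mu_2$ in $R_{\mathcal{T}}[S_2]$; $m$ "has a scar on" an edge of $\mathcal{T}[Z]$ if its left-scar or right-scar lies on it. $\mathcal{K}_1$ is the size-$4$ tanglegram in which each tree has root adjacent to an internal vertex whose two children each have two leaf children, with left cherries $\{l_1,l_2\},\{l_3,l_4\}$, right cherries $\{r_1,r_2\},\{r_3,r_4\}$ and matching $l_1r_1, l_2r_3, l_3r_2, l_4r_4$. $\mathcal{K}_2$ is the size-$4$ tanglegram whose left tree has root $\rho_L$ adjacent to $v_1$, $v_1$ has children leaf $l_1$ and $v_2$, $v_2$ has children leaf $l_2$ and $v_3$, $v_3$ has leaf children $l_3,l_4$; whose right tree has root $\rho_R$ adjacent to $w_1$, $w_1$ has children leaf $r_1$ and $w_2$, $w_2$ has children leaf $r_2$ and $w_3$, $w_3$ has leaf children $r_3,r_4$; and whose matching is $u_2=l_1r_4$, $x=l_2r_2$, $y=l_3r_3$, $u_1=l_4r_1$. A set $Y\subseteq\sigma_{\mathcal{T}}$ is cross-responsible if $\mathcal{T}[Y]$ is isomorphic to $\mathcal{K}_1$ or $\mathcal{K}_2$. Standardized labeling of $\mathcal{K}_2$ (the isomorphism $\mathcal{T}[X]\cong\mathcal{K}_2$ is unique, so the labels transfer to $\mathcal{T}[X]$): left tree edges $a_1=\rho_Lv_1$,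 $c_1=v_1l_1$, $b_1=v_1v_2$, $d_1=v_2l_2$, $e_1=v_2v_3$, $f_1=v_3l_3$, $g_1=v_3l_4$; right tree edges $a_2=\rho_Rw_1$, $c_2=w_1r_1$, $b_2=w_1w_2$, $d_2=w_2r_2$, $e_2=w_2w_3$, $f_2=w_3r_3$, $g_2=w_3r_4$. -}

module Defs where

open import Data.Nat using (ℕ)
open import Data.Fin using (Fin; zero; suc)
open import Data.Fin.Subset using (Subset; _∈_; _∉_)
open import Data.List using (List; []; _∷_; _++_; [_])
open import Data.List.Relation.Binary.Permutation.Propositional using (_↭_)
open import Data.Fin using () renaming (zero to f0)
open import Data.List using () renaming (allFin to allFinL)
open import Data.Maybe using (Maybe; just; nothing)
open import Data.Bool using (Bool; true; false)
open import Data.Product using (Σ; ∃; ∃-syntax; _×_; _,_)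
open import Data.Sum using (_⊎_)
open import Relation.Nullary using (¬_; yes; no)
open import Relation.Binary.PropositionalEquality using (_≡_)
open import Data.Fin.Subset.Properties using (_∈?_)

-- A value of 'BTree A' describes the part of a rooted binary tree below
-- the (degree-1) root ρ: 'leaf a' is a single leaf (the tree ρ–a), and
-- 'node l r' is the unique child of ρ (or, recursively, an internal
-- vertex of degree 3) with two subtrees.  Children are unordered; the
-- order in 'node' is irrelevant up to 'TreeIso'.

data BTree (A : Set) : Set where
  leaf : A → BTree A
  node : BTree A → BTree A → BTree A

leaves : {A : Set} → BTree A → List A
leaves (leaf a)   = a ∷ []
leaves (node l r) = leaves l ++ leaves r

-- Tanglegrams of size n: the matching edges are the elements of Fin n;
-- matching edge i joins the left leaf labelled i to the right leaf
-- labelled i.  Each tree carries every label exactly once.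

record Tanglegram (n : ℕ) : Set where
  field
    left       : BTree (Fin n)
    right      : BTree (Fin n)
    left-perm  : leaves left ↭ allFinL n
    right-perm : leaves right ↭ allFinL n
open Tanglegram public

-- Induced subtree T[S] for a set S of labels (suppressing degree-2
-- vertices; the root is kept).  Undefined ('nothing') when S contains
-- no leaf of the tree.

restrict : {n : ℕ} → Subset n → BTree (Fin n) → Maybe (BTree (Fin n))
restrict S (leaf a) with a ∈? S
... | yes _ = just (leaf a)
... | no  _ = nothing
restrict S (node l r) with restrict S l | restrict S r
... | just l' | just r'  = just (node l' r')
... | just l' | nothing  = just l'
... | nothing | just r'  = just r'
... | nothing | nothing  = nothing

data TreeIso {A B : Set} (f : A → B) : BTree A → BTree B → Set where
  leaf-iso : ∀ a → TreeIso f (leaf a) (leaf (f a))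
  node-iso : ∀ {l r l' r'} →
             (TreeIso f l l' × TreeIso f r r') ⊎ (TreeIso f l r' × TreeIso f r l') →
             TreeIso f (node l r) (node l' r')

-- Tanglegram isomorphism T[Z] ≅ K (K of size k), witnessed by a map f of
-- matching edges of T[Z] to matching edges of K compatible with both
-- tree isomorphisms.
SubIsoVia : {n k : ℕ} → Tanglegram n → Subset n →
            BTree (Fin k) → BTree (Fin k) → (Fin n → Fin k) → Set
SubIsoVia T Z KL KR f =
  ∃[ L' ] ∃[ R' ] (restrict Z (left T) ≡ just L' × restrict Z (right T) ≡ just R'
                   × TreeIso f L' KL × TreeIso f R' KR)

SubIso : {n k : ℕ} → Tanglegram n → Subset n → BTree (Fin k) → BTree (Fin k) → Set
SubIso T Z KL KR = ∃[ f ] SubIsoVia T Z KL KR f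

private
  e0 e1 e2 e3 : Fin 4
  e0 = zero
  e1 = suc zero
  e2 = suc (suc zero)
  e3 = suc (suc (suc zero))

-- K₁: matching l1r1 = e0, l2r3 = e1, l3r2 = e2, l4r4 = e3.
K1-left K1-right : BTree (Fin 4)
K1-left  = node (node (leaf e0) (leaf e1)) (node (leaf e2) (leaf e3))
K1-right = node (node (leaf e0) (leaf e2)) (node (leaf e1) (leaf e3))

-- K₂: u₂ = l1r4 = e0, x = l2r2 = e1, y = l3r3 = e2, u₁ = l4r1 = e3.
K2-left K2-right : BTree (Fin 4)
K2-left  = node (leaf e0) (node (leaf e1) (node (leaf e2) (leaf e3)))
K2-right = node (leaf e3) (node (leaf e1) (node (leaf e2) (leaf e0)))

K2-x : Fin 4
K2-x = e1

CrossResponsible : {n : ℕ} → Tanglegram n → Subset n → Set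
CrossResponsible T Y = SubIso T Y K1-left K1-right ⊎ SubIso T Y K2-left K2-right

-- Vertices of a tree as positions (paths from the child of the root).

data Dir : Set where
  ↙ ↘ : Dir

Pos : Set
Pos = List Dir

subtree : {A : Set} → BTree A → Pos → Maybe (BTree A)
subtree t []              = just t
subtree (leaf a) (_ ∷ _)  = nothing
subtree (node l r) (↙ ∷ p) = subtree l p
subtree (node l r) (↘ ∷ p) = subtree r p

Prefix : Pos → Pos → Set
Prefix p q = ∃[ s ] p ++ s ≡ q

StrictPrefix : Pos → Pos → Set
StrictPrefix p q = ∃[ d ] ∃[ s ] p ++ d ∷ s ≡ q

Below : {A : Set} → BTree A → Pos → A → Set
Below t p a = ∃[ s ] subtree t (p ++ s) ≡ just (leaf a)

module _ {n : ℕ} (t : BTree (Fin n)) (S : Subset n) where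

  -- p is a (non-root) vertex of T⟦S⟧
  InK : Pos → Set
  InK p = ∃[ s ] (s ∈ S × Below t p s)

  -- p has degree 2 in T⟦S⟧ (suppressed when forming T[S])
  Suppressed : Pos → Set
  Suppressed p = (InK (p ++ [ ↙ ]) × ¬ InK (p ++ [ ↘ ]))
               ⊎ (¬ InK (p ++ [ ↙ ]) × InK (p ++ [ ↘ ]))

  -- p is a non-root vertex of T[S] (a leaf in S or a branching vertex)
  RestrVertex : Pos → Set
  RestrVertex p = (∃[ s ] (s ∈ S × subtree t p ≡ just (leaf s)))
                ⊎ (InK (p ++ [ ↙ ]) × InK (p ++ [ ↘ ]))

  -- The scar of the leaf w in T[S] is on the edge e of T[S] whose lower
  -- endpoint is q: the first vertex m of T⟦S⟧ met on the path from w to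
  -- the root is an interior vertex of P_e, i.e. m is a proper ancestor
  -- of q and all vertices from m down to q (excluding q) are suppressed.
  ScarOn : Fin n → Pos → Set
  ScarOn w q =
    RestrVertex q ×
    ∃[ pw ] ∃[ m ] ( subtree t pw ≡ just (leaf w)
                   × Prefix m pw × InK m
                   × (∀ p → StrictPrefix m p → Prefix p pw → ¬ InK p)
                   × StrictPrefix m q
                   × (∀ p → Prefix m p → StrictPrefix p q → Suppressed p))

  ScarOnLeafEdge : Fin n → Fin n → Set
  ScarOnLeafEdge w s = ∃[ q ] (subtree t q ≡ just (leaf s) × ScarOn w q)

-- Suppose m₁ ∉ X scars the pendant edge d₁ of x in the left tree and m₂ ∉ X scars d₂ in the
-- right tree.  Adding m₁ to X grafts m₁ as a sibling of x in the left tree; adding m₂ afterwards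
-- grafts it onto some edge; symmetrically on the right.  So T[X ∪ {m₁, m₂}] is, up to isomorphism,
-- one of finitely many tanglegrams with at most six matching edges, built from K₂ by these grafts.
-- Each of them contains a cross-responsible set using m₁ or m₂ (when m₁ = m₂, simply m₁ in place
-- of x), as an exhaustive check confirms.  Pulling that set back to T gives a second
-- cross-responsible set, contradicting uniqueness.

module Submission where

open import Defs
open import Data.Nat using (ℕ)
open import Data.Fin using (Fin; zero; _≟_; _↑ˡ_; #_)
open import Data.Fin.Subset using (Subset; _∈_; _∉_; _⊆_; _∪_; ⁅_⁆; ∁)
open import Data.Fin.Subset.Properties using (_∈?_; _⊆?_; x∈p∪q⁻; x∈p∪q⁺; x∈⁅x⁆; x∈⁅y⁆⇒x≡y; x∈∁p⇒x∉p)
open import Data.List using (List; []; _∷_; _++_; [_]; map; concatMap; allFin)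
open import Data.List.Membership.Propositional using (lose) renaming (_∈_ to _∈ₗ_)
open import Data.List.Membership.Propositional.Properties
  using (∈-++⁺ˡ; ∈-++⁺ʳ; ∈-++⁻; ∈-map⁺; ∈-concatMap⁺; ∈-allFin)
open import Data.List.Relation.Unary.Any using (Any; here; there; any?; satisfied)
open import Data.List.Relation.Unary.All as All using (All; all?)
import Data.List.Relation.Unary.All.Properties as All
open import Data.List.Relation.Unary.AllPairs using ([]; _∷_)
open import Data.List.Relation.Unary.Unique.Propositional using (Unique)
open import Data.List.Relation.Unary.Unique.Propositional.Properties using (allFin⁺)
open import Data.List.Relation.Binary.Disjoint.Propositional using (Disjoint)
open import Data.List.Relation.Binary.Permutation.Propositional using (_↭_; ↭-sym; ↭⇒↭ₛ)
open import Data.List.Relation.Binary.Permutation.Propositional.Properties using (∈-resp-↭)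
import Data.List.Relation.Binary.Permutation.Setoid.Properties as Perm
open import Data.Maybe as Maybe using (Maybe; just; nothing; is-just; fromMaybe; _>>=_)
open import Data.Maybe.Relation.Unary.Any as AnyM using (just) renaming (Any to AnyM)
open import Data.Maybe.Relation.Unary.All as AllM using (just; nothing) renaming (All to AllM)
open import Data.Maybe.Relation.Binary.Pointwise as Pointwise using (Pointwise; just; nothing)
open import Data.Product using (∃; ∃-syntax; _×_; _,_; proj₂)
open import Data.Sum using (_⊎_; inj₁; inj₂)
open import Data.Vec as Vec using (Vec; []; _∷_; tabulate; lookup)
open import Data.Vec.Properties using ([]=⇒lookup; lookup⇒[]=; lookup∘tabulate)
open import Data.Empty using (⊥-elim)
open import Function using (id; _∘_; case_of_)
open import Relation.Nullary using (¬_; yes; no; Dec)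
open import Relation.Nullary.Decidable using (map′; _×-dec_; _⊎-dec_; toWitness)
open import Relation.Binary.PropositionalEquality
  using (_≡_; _≢_; refl; sym; trans; cong; subst; subst₂; setoid)

private
  variable
    A B C : Set
    n k : ℕ

mapTree : (A → B) → BTree A → BTree B
mapTree h (leaf a)   = leaf (h a)
mapTree h (node l r) = node (mapTree h l) (mapTree h r)

infix 4 _≅_
_≅_ : BTree A → BTree A → Set
_≅_ = TreeIso id

≅-refl : (t : BTree A) → t ≅ t
≅-refl (leaf a)   = leaf-iso a
≅-refl (node l r) = node-iso (inj₁ (≅-refl l , ≅-refl r))

≅-TreeIso-trans : ∀ {f : A → B} {D E : BTree A} {K : BTree B} → D ≅ E → TreeIso f E K → TreeIso f D K
≅-TreeIso-trans (leaf-iso a) (leaf-iso .a) = leaf-iso a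
≅-TreeIso-trans (node-iso (inj₁ (p , q))) (node-iso (inj₁ (p′ , q′))) =
  node-iso (inj₁ (≅-TreeIso-trans p p′ , ≅-TreeIso-trans q q′))
≅-TreeIso-trans (node-iso (inj₁ (p , q))) (node-iso (inj₂ (p′ , q′))) =
  node-iso (inj₂ (≅-TreeIso-trans p p′ , ≅-TreeIso-trans q q′))
≅-TreeIso-trans (node-iso (inj₂ (p , q))) (node-iso (inj₁ (p′ , q′))) =
  node-iso (inj₂ (≅-TreeIso-trans p q′ , ≅-TreeIso-trans q p′))
≅-TreeIso-trans (node-iso (inj₂ (p , q))) (node-iso (inj₂ (p′ , q′))) =
  node-iso (inj₁ (≅-TreeIso-trans p q′ , ≅-TreeIso-trans q p′))

mapTree-≅ : ∀ {f : A → B} (h : A → C) (g : B → C) {L : BTree A} {K : BTree B} → TreeIso f L K →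
            (∀ {a} → a ∈ₗ leaves L → h a ≡ g (f a)) → mapTree h L ≅ mapTree g K
mapTree-≅ h g (leaf-iso a) h≡gf rewrite h≡gf (here refl) = leaf-iso _
mapTree-≅ h g (node-iso {l} (inj₁ (p , q))) h≡gf =
  node-iso (inj₁ (mapTree-≅ h g p (h≡gf ∘ ∈-++⁺ˡ) , mapTree-≅ h g q (h≡gf ∘ ∈-++⁺ʳ (leaves l))))
mapTree-≅ h g (node-iso {l} (inj₂ (p , q))) h≡gf =
  node-iso (inj₂ (mapTree-≅ h g p (h≡gf ∘ ∈-++⁺ˡ) , mapTree-≅ h g q (h≡gf ∘ ∈-++⁺ʳ (leaves l))))

TreeIso-mapTree⁻ : ∀ (h : A → B) {g : B → C} (L : BTree A) {K : BTree C} →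
                   TreeIso g (mapTree h L) K → TreeIso (g ∘ h) L K
TreeIso-mapTree⁻ h (leaf a) (leaf-iso _) = leaf-iso a
TreeIso-mapTree⁻ h (node l r) (node-iso (inj₁ (p , q))) =
  node-iso (inj₁ (TreeIso-mapTree⁻ h l p , TreeIso-mapTree⁻ h r q))
TreeIso-mapTree⁻ h (node l r) (node-iso (inj₂ (p , q))) =
  node-iso (inj₂ (TreeIso-mapTree⁻ h l p , TreeIso-mapTree⁻ h r q))

treeIso? : (f : A → Fin k) (E : BTree A) (K : BTree (Fin k)) → Dec (TreeIso f E K)
treeIso? f (leaf a) (leaf b) with f a ≟ b
... | yes refl = yes (leaf-iso a)
... | no fa≢b  = no λ { (leaf-iso _) → fa≢b refl }
treeIso? f (leaf _) (node _ _) = no λ ()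
treeIso? f (node _ _) (leaf _) = no λ ()
treeIso? f (node l r) (node l′ r′) =
  map′ node-iso (λ { (node-iso i) → i })
       ((treeIso? f l l′ ×-dec treeIso? f r r′) ⊎-dec (treeIso? f l r′ ×-dec treeIso? f r l′))

unique-leaves : ∀ (t : BTree (Fin n)) → leaves t ↭ allFin n → Unique (leaves t)
unique-leaves {n} t t↭ = Perm.Unique-resp-↭ (setoid (Fin n)) (↭⇒↭ₛ (↭-sym t↭)) (allFin⁺ n)

∈-leaves : ∀ (t : BTree (Fin n)) → leaves t ↭ allFin n → ∀ a → a ∈ₗ leaves t
∈-leaves t t↭ a = ∈-resp-↭ (↭-sym t↭) (∈-allFin a)

Unique-++⁻ : ∀ (xs : List A) {ys} → Unique (xs ++ ys) → Unique xs × Unique ys × Disjoint xs ys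
Unique-++⁻ []       u = [] , u , λ ()
Unique-++⁻ (x ∷ xs) (x∉ ∷ u) with Unique-++⁻ xs u
... | u-xs , u-ys , xs#ys = All.++⁻ˡ xs x∉ ∷ u-xs , u-ys , disjoint
  where
  disjoint : Disjoint (x ∷ xs) _
  disjoint (here refl , v∈ys)  = All.lookup x∉ (∈-++⁺ʳ xs v∈ys) refl
  disjoint (there v∈xs , v∈ys) = xs#ys (v∈xs , v∈ys)

∈-∪⁅⁆⁻ : ∀ (S : Subset n) {m a} → a ∈ S ∪ ⁅ m ⁆ → a ∈ S ⊎ a ≡ m
∈-∪⁅⁆⁻ S {m} a∈ with x∈p∪q⁻ S ⁅ m ⁆ a∈
... | inj₁ a∈S   = inj₁ a∈S
... | inj₂ a∈⁅m⁆ = inj₂ (x∈⁅y⁆⇒x≡y m a∈⁅m⁆)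

∈-∪⁅⁆⁺ : ∀ {S : Subset n} {m a} → a ∈ S ⊎ a ≡ m → a ∈ S ∪ ⁅ m ⁆
∈-∪⁅⁆⁺ (inj₁ a∈S)  = x∈p∪q⁺ (inj₁ a∈S)
∈-∪⁅⁆⁺ (inj₂ refl) = x∈p∪q⁺ (inj₂ (x∈⁅x⁆ _))

∉-∪⁅⁆ : ∀ {S : Subset n} {m a} → a ∉ S → a ≢ m → a ∉ S ∪ ⁅ m ⁆
∉-∪⁅⁆ {S = S} a∉S a≢m a∈ with ∈-∪⁅⁆⁻ S a∈
... | inj₁ a∈S = a∉S a∈S
... | inj₂ a≡m = a≢m a≡m

infix 9 _⁻¹_
_⁻¹_ : (Fin n → Fin k) → Subset k → Subset n
h ⁻¹ Y = tabulate (λ a → lookup Y (h a))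

∈-⁻¹⁺ : ∀ (h : Fin n → Fin k) {Y a} → h a ∈ Y → a ∈ h ⁻¹ Y
∈-⁻¹⁺ h {a = a} ha∈Y = lookup⇒[]= a _ (trans (lookup∘tabulate _ a) ([]=⇒lookup ha∈Y))

∈-⁻¹⁻ : ∀ (h : Fin n → Fin k) {Y a} → a ∈ h ⁻¹ Y → h a ∈ Y
∈-⁻¹⁻ h {Y} {a} a∈ = lookup⇒[]= (h a) Y (trans (sym (lookup∘tabulate _ a)) ([]=⇒lookup a∈))

-- Restriction

merge : Maybe (BTree A) → Maybe (BTree A) → Maybe (BTree A)
merge (just l) (just r) = just (node l r)
merge (just l) nothing  = just l
merge nothing  r        = r

restrict-node : ∀ (S : Subset n) l r → restrict S (node l r) ≡ merge (restrict S l) (restrict S r)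
restrict-node S l r with restrict S l | restrict S r
... | just _  | just _  = refl
... | just _  | nothing = refl
... | nothing | just _  = refl
... | nothing | nothing = refl

restrict-leaf-∈ : ∀ {S : Subset n} {a} → a ∈ S → restrict S (leaf a) ≡ just (leaf a)
restrict-leaf-∈ {S = S} {a} a∈S with a ∈? S
... | yes _  = refl
... | no a∉S = ⊥-elim (a∉S a∈S)

restrict-leaf-∉ : ∀ {S : Subset n} {a} → a ∉ S → restrict S (leaf a) ≡ nothing
restrict-leaf-∉ {S = S} {a} a∉S with a ∈? S
... | yes a∈S = ⊥-elim (a∉S a∈S)
... | no _    = refl

restrict-disjoint : ∀ (S : Subset n) t → (∀ {a} → a ∈ₗ leaves t → a ∉ S) → restrict S t ≡ nothing
restrict-disjoint S (leaf a)   t∩S≡∅ = restrict-leaf-∉ (t∩S≡∅ (here refl))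
restrict-disjoint S (node l r) t∩S≡∅
  rewrite restrict-node S l r
        | restrict-disjoint S l (t∩S≡∅ ∘ ∈-++⁺ˡ)
        | restrict-disjoint S r (t∩S≡∅ ∘ ∈-++⁺ʳ (leaves l)) = refl

merge-All : ∀ {P : A → Set} {x y} → AllM (All P ∘ leaves) x → AllM (All P ∘ leaves) y →
            AllM (All P ∘ leaves) (merge x y)
merge-All (just p) (just q) = just (All.++⁺ p q)
merge-All (just p) nothing  = just p
merge-All nothing  q        = q

restrict-leaves : ∀ (S : Subset n) t → AllM (All (_∈ S) ∘ leaves) (restrict S t)
restrict-leaves S (leaf a) with a ∈? S
... | yes a∈S = just (a∈S All.∷ All.[])
... | no _    = nothing
restrict-leaves S (node l r)
  rewrite restrict-node S l r = merge-All (restrict-leaves S l) (restrict-leaves S r)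

∈-restrict : ∀ (S : Subset n) t {L a} → restrict S t ≡ just L → a ∈ₗ leaves L → a ∈ S
∈-restrict S t t∣S≡L = All.lookup (AllM.drop-just (subst (AllM _) t∣S≡L (restrict-leaves S t)))

restrict-∪-fresh : ∀ (S : Subset n) {m} t → ¬ m ∈ₗ leaves t → restrict (S ∪ ⁅ m ⁆) t ≡ restrict S t
restrict-∪-fresh S {m} (leaf a) m∉t with a ∈? S ∪ ⁅ m ⁆ | a ∈? S
... | yes _  | yes _   = refl
... | no _   | no _    = refl
... | no a∉  | yes a∈S = ⊥-elim (a∉ (∈-∪⁅⁆⁺ (inj₁ a∈S)))
... | yes a∈ | no a∉S with ∈-∪⁅⁆⁻ S a∈
...   | inj₁ a∈S  = ⊥-elim (a∉S a∈S)
...   | inj₂ refl = ⊥-elim (m∉t (here refl))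
restrict-∪-fresh S {m} (node l r) m∉t
  rewrite restrict-node (S ∪ ⁅ m ⁆) l r | restrict-node S l r
        | restrict-∪-fresh S l (m∉t ∘ ∈-++⁺ˡ) | restrict-∪-fresh S r (m∉t ∘ ∈-++⁺ʳ (leaves l)) = refl

map-merge : ∀ (h : A → B) (x y : Maybe (BTree A)) →
            Maybe.map (mapTree h) (merge x y) ≡ merge (Maybe.map (mapTree h) x) (Maybe.map (mapTree h) y)
map-merge h (just _) (just _) = refl
map-merge h (just _) nothing  = refl
map-merge h nothing  _        = refl

restrict-mapTree : ∀ (h : Fin n → Fin k) (Y : Subset k) t →
                   restrict Y (mapTree h t) ≡ Maybe.map (mapTree h) (restrict (h ⁻¹ Y) t)
restrict-mapTree h Y (leaf a) with h a ∈? Y | a ∈? h ⁻¹ Y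
... | yes _    | yes _   = refl
... | no _     | no _    = refl
... | yes ha∈Y | no a∉   = ⊥-elim (a∉ (∈-⁻¹⁺ h ha∈Y))
... | no ha∉Y  | yes a∈  = ⊥-elim (ha∉Y (∈-⁻¹⁻ h a∈))
restrict-mapTree h Y (node l r)
  rewrite restrict-node Y (mapTree h l) (mapTree h r) | restrict-node (h ⁻¹ Y) l r
        | restrict-mapTree h Y l | restrict-mapTree h Y r
  = sym (map-merge h (restrict (h ⁻¹ Y) l) (restrict (h ⁻¹ Y) r))

bind-merge : ∀ (S : Subset n) (x y : Maybe (BTree (Fin n))) →
             (merge x y >>= restrict S) ≡ merge (x >>= restrict S) (y >>= restrict S)
bind-merge S (just l) (just r) = restrict-node S l r
bind-merge S (just l) nothing with restrict S l
... | just _  = refl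
... | nothing = refl
bind-merge S nothing  _        = refl

restrict-⊆ : ∀ {S Z : Subset n} → S ⊆ Z → ∀ t → restrict S t ≡ (restrict Z t >>= restrict S)
restrict-⊆ {Z = Z} S⊆Z (leaf a) with a ∈? Z
... | yes _  = refl
... | no a∉Z = restrict-leaf-∉ (a∉Z ∘ S⊆Z)
restrict-⊆ {S = S} {Z} S⊆Z (node l r)
  rewrite restrict-node S l r | restrict-node Z l r | restrict-⊆ S⊆Z l | restrict-⊆ S⊆Z r
  = sym (bind-merge S (restrict Z l) (restrict Z r))

merge-≅ : ∀ {x x′ y y′ : Maybe (BTree A)} → Pointwise _≅_ x x′ → Pointwise _≅_ y y′ →
          Pointwise _≅_ (merge x y) (merge x′ y′)
merge-≅ (just p) (just q) = just (node-iso (inj₁ (p , q)))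
merge-≅ (just p) nothing  = just p
merge-≅ nothing  q        = q

merge-≅-swap : ∀ {x x′ y y′ : Maybe (BTree A)} → Pointwise _≅_ x y′ → Pointwise _≅_ y x′ →
               Pointwise _≅_ (merge x y) (merge x′ y′)
merge-≅-swap (just p) (just q) = just (node-iso (inj₂ (p , q)))
merge-≅-swap (just p) nothing  = just p
merge-≅-swap nothing  (just q) = just q
merge-≅-swap nothing  nothing  = nothing

restrict-≅ : ∀ (S : Subset n) {D E} → D ≅ E → Pointwise _≅_ (restrict S D) (restrict S E)
restrict-≅ S (leaf-iso a) = Pointwise.refl (λ {t} → ≅-refl t)
restrict-≅ S (node-iso {l} {r} {l′} {r′} (inj₁ (p , q)))
  rewrite restrict-node S l r | restrict-node S l′ r′ = merge-≅ (restrict-≅ S p) (restrict-≅ S q)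
restrict-≅ S (node-iso {l} {r} {l′} {r′} (inj₂ (p , q)))
  rewrite restrict-node S l r | restrict-node S l′ r′ = merge-≅-swap (restrict-≅ S p) (restrict-≅ S q)

RestrictIso : Subset k → (Fin k → B) → BTree (Fin k) → BTree B → Set
RestrictIso Y g t K = AnyM (λ E → TreeIso g E K) (restrict Y t)

CrossResponsibleVia : BTree (Fin k) → BTree (Fin k) → Subset k → (Fin k → Fin 4) → Set
CrossResponsibleVia D D′ Y g = (RestrictIso Y g D K1-left × RestrictIso Y g D′ K1-right)
                             ⊎ (RestrictIso Y g D K2-left × RestrictIso Y g D′ K2-right)

AnyM⇒just : ∀ {P : A → Set} {m} → AnyM P m → ∃[ a ] (m ≡ just a × P a)
AnyM⇒just (just p) = _ , refl , p

AnyM-map⁻ : ∀ {P : B → Set} {h : A → B} {m} → AnyM P (Maybe.map h m) → AnyM (P ∘ h) m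
AnyM-map⁻ {m = just _} (just p) = just p

restrictIso-pullback : ∀ (h : Fin n → Fin k) t {Z : Subset n} {Y : Subset k} {g : Fin k → B} {L D K} →
                       restrict Z t ≡ just L → h ⁻¹ Y ⊆ Z → mapTree h L ≅ D →
                       RestrictIso Y g D K → RestrictIso (h ⁻¹ Y) (g ∘ h) t K
restrictIso-pullback h t {Z} {Y} {g} {L} {D} {K} t∣Z≡L h⁻¹Y⊆Z hL≅D D∣Y≅K =
  subst (AnyM (λ E → TreeIso (g ∘ h) E K)) (sym t∣h⁻¹Y≡L∣h⁻¹Y)
        (AnyM.map (λ {E} → TreeIso-mapTree⁻ h E) (AnyM-map⁻ hL∣Y≅K))
  where
  t∣h⁻¹Y≡L∣h⁻¹Y : restrict (h ⁻¹ Y) t ≡ restrict (h ⁻¹ Y) L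
  t∣h⁻¹Y≡L∣h⁻¹Y = trans (restrict-⊆ h⁻¹Y⊆Z t) (cong (_>>= restrict (h ⁻¹ Y)) t∣Z≡L)

  transport : ∀ {x y} → Pointwise _≅_ x y → AnyM (λ E → TreeIso g E K) y → AnyM (λ E → TreeIso g E K) x
  transport (just E≅E′) (just E′≅K) = just (≅-TreeIso-trans E≅E′ E′≅K)

  hL∣Y≅K : AnyM (λ E → TreeIso g E K) (Maybe.map (mapTree h) (restrict (h ⁻¹ Y) L))
  hL∣Y≅K = subst (AnyM (λ E → TreeIso g E K)) (restrict-mapTree h Y L) (transport (restrict-≅ Y hL≅D) D∣Y≅K)

module _ (T : Tanglegram n) where

  subIsoVia : ∀ {Z : Subset n} {KL KR : BTree (Fin k)} {f} →
              RestrictIso Z f (left T) KL → RestrictIso Z f (right T) KR → SubIsoVia T Z KL KR f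
  subIsoVia isoL isoR with AnyM⇒just isoL | AnyM⇒just isoR
  ... | L , eL , L≅ | R , eR , R≅ = L , R , eL , eR , L≅ , R≅

  crossResponsible-pullback :
    ∀ (h : Fin n → Fin k) {Zₗ Zᵣ : Subset n} {Y : Subset k} {g L R D D′} →
    restrict Zₗ (left T) ≡ just L → restrict Zᵣ (right T) ≡ just R → h ⁻¹ Y ⊆ Zₗ → h ⁻¹ Y ⊆ Zᵣ →
    mapTree h L ≅ D → mapTree h R ≅ D′ → CrossResponsibleVia D D′ Y g → CrossResponsible T (h ⁻¹ Y)
  crossResponsible-pullback h {Y = Y} {g} {D = D} {D′} eL eR ⊆Zₗ ⊆Zᵣ hL≅D hR≅D′ = λ
    { (inj₁ (isoL , isoR)) → inj₁ (g ∘ h , pull isoL isoR)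
    ; (inj₂ (isoL , isoR)) → inj₂ (g ∘ h , pull isoL isoR) }
    where
    pull : ∀ {KL KR} → RestrictIso Y g D KL → RestrictIso Y g D′ KR → SubIsoVia T (h ⁻¹ Y) KL KR (g ∘ h)
    pull isoL isoR = subIsoVia (restrictIso-pullback h (left T) eL ⊆Zₗ hL≅D isoL)
                               (restrictIso-pullback h (right T) eR ⊆Zᵣ hR≅D′ isoR)

-- Grafting a leaf

data GraftedAt (x m : A) : BTree A → BTree A → Set where
  atˡ : GraftedAt x m (leaf x) (node (leaf x) (leaf m))
  atʳ : GraftedAt x m (leaf x) (node (leaf m) (leaf x))
  inˡ : ∀ {l l′ r} → GraftedAt x m l l′ → GraftedAt x m (node l r) (node l′ r)
  inʳ : ∀ {l r r′} → GraftedAt x m r r′ → GraftedAt x m (node l r) (node l r′)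

data Grafted (m : A) : BTree A → BTree A → Set where
  aboveˡ : ∀ {t} → Grafted m t (node t (leaf m))
  aboveʳ : ∀ {t} → Grafted m t (node (leaf m) t)
  inˡ    : ∀ {l l′ r} → Grafted m l l′ → Grafted m (node l r) (node l′ r)
  inʳ    : ∀ {l r r′} → Grafted m r r′ → Grafted m (node l r) (node l r′)

GraftedAt-map : ∀ (h : A → B) {x m t t′} → GraftedAt x m t t′ →
                GraftedAt (h x) (h m) (mapTree h t) (mapTree h t′)
GraftedAt-map h atˡ     = atˡ
GraftedAt-map h atʳ     = atʳ
GraftedAt-map h (inˡ g) = inˡ (GraftedAt-map h g)
GraftedAt-map h (inʳ g) = inʳ (GraftedAt-map h g)

Grafted-map : ∀ (h : A → B) {m t t′} → Grafted m t t′ → Grafted (h m) (mapTree h t) (mapTree h t′)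
Grafted-map h aboveˡ  = aboveˡ
Grafted-map h aboveʳ  = aboveʳ
Grafted-map h (inˡ g) = inˡ (Grafted-map h g)
Grafted-map h (inʳ g) = inʳ (Grafted-map h g)

-- Each graft is listed in one orientation only, which suffices up to isomorphism (graftedAt-≅,
-- grafted-≅).

graftsAt : Fin k → Fin k → BTree (Fin k) → List (BTree (Fin k))
graftsAt x m (leaf a) with a ≟ x
... | yes _ = [ node (leaf a) (leaf m) ]
... | no _  = []
graftsAt x m (node l r) = map (λ l′ → node l′ r) (graftsAt x m l) ++ map (node l) (graftsAt x m r)

grafts graftsInside : A → BTree A → List (BTree A)
grafts m t = node t (leaf m) ∷ graftsInside m t
graftsInside m (leaf _)   = []
graftsInside m (node l r) = map (λ l′ → node l′ r) (grafts m l) ++ map (node l) (grafts m r)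

∈-graftsAtˡ : ∀ {x m : Fin k} {l r E} → E ∈ₗ graftsAt x m l → node E r ∈ₗ graftsAt x m (node l r)
∈-graftsAtˡ E∈ = ∈-++⁺ˡ (∈-map⁺ _ E∈)

∈-graftsAtʳ : ∀ {x m : Fin k} {l r E} → E ∈ₗ graftsAt x m r → node l E ∈ₗ graftsAt x m (node l r)
∈-graftsAtʳ {x = x} {m} {l} E∈ = ∈-++⁺ʳ (map _ (graftsAt x m l)) (∈-map⁺ _ E∈)

∈-graftsˡ : ∀ {m : A} {l r E} → E ∈ₗ grafts m l → node E r ∈ₗ grafts m (node l r)
∈-graftsˡ E∈ = there (∈-++⁺ˡ (∈-map⁺ _ E∈))

∈-graftsʳ : ∀ {m : A} {l r E} → E ∈ₗ grafts m r → node l E ∈ₗ grafts m (node l r)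
∈-graftsʳ {m = m} {l} E∈ = there (∈-++⁺ʳ (map _ (grafts m l)) (∈-map⁺ _ E∈))

graftedAt-≅ : ∀ {x m : Fin k} {D D′ K} → GraftedAt x m D D′ → D ≅ K →
              ∃[ E ] (E ∈ₗ graftsAt x m K × D′ ≅ E)
graftedAt-≅ {x = x} atˡ (leaf-iso _) with x ≟ x
... | yes _  = _ , here refl , ≅-refl _
... | no x≢x = ⊥-elim (x≢x refl)
graftedAt-≅ {x = x} {m} atʳ (leaf-iso _) with x ≟ x
... | yes _  = _ , here refl , node-iso (inj₂ (leaf-iso m , leaf-iso x))
... | no x≢x = ⊥-elim (x≢x refl)
graftedAt-≅ (inˡ g) (node-iso (inj₁ (l≅l′ , r≅r′))) =
  let E , E∈ , D′≅E = graftedAt-≅ g l≅l′ in _ , ∈-graftsAtˡ E∈ , node-iso (inj₁ (D′≅E , r≅r′))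
graftedAt-≅ (inˡ g) (node-iso (inj₂ (l≅r′ , r≅l′))) =
  let E , E∈ , D′≅E = graftedAt-≅ g l≅r′ in _ , ∈-graftsAtʳ E∈ , node-iso (inj₂ (D′≅E , r≅l′))
graftedAt-≅ (inʳ g) (node-iso (inj₁ (l≅l′ , r≅r′))) =
  let E , E∈ , D′≅E = graftedAt-≅ g r≅r′ in _ , ∈-graftsAtʳ E∈ , node-iso (inj₁ (l≅l′ , D′≅E))
graftedAt-≅ (inʳ g) (node-iso (inj₂ (l≅r′ , r≅l′))) =
  let E , E∈ , D′≅E = graftedAt-≅ g r≅l′ in _ , ∈-graftsAtˡ E∈ , node-iso (inj₂ (l≅r′ , D′≅E))

grafted-≅ : ∀ {m : A} {D D′ K} → Grafted m D D′ → D ≅ K → ∃[ E ] (E ∈ₗ grafts m K × D′ ≅ E)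
grafted-≅ {m = m} aboveˡ D≅K = _ , here refl , node-iso (inj₁ (D≅K , leaf-iso m))
grafted-≅ {m = m} aboveʳ D≅K = _ , here refl , node-iso (inj₂ (leaf-iso m , D≅K))
grafted-≅ (inˡ g) (node-iso (inj₁ (l≅l′ , r≅r′))) =
  let E , E∈ , D′≅E = grafted-≅ g l≅l′ in _ , ∈-graftsˡ E∈ , node-iso (inj₁ (D′≅E , r≅r′))
grafted-≅ (inˡ g) (node-iso (inj₂ (l≅r′ , r≅l′))) =
  let E , E∈ , D′≅E = grafted-≅ g l≅r′ in _ , ∈-graftsʳ E∈ , node-iso (inj₂ (D′≅E , r≅l′))
grafted-≅ (inʳ g) (node-iso (inj₁ (l≅l′ , r≅r′))) =
  let E , E∈ , D′≅E = grafted-≅ g r≅r′ in _ , ∈-graftsʳ E∈ , node-iso (inj₁ (l≅l′ , D′≅E))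
grafted-≅ (inʳ g) (node-iso (inj₂ (l≅r′ , r≅l′))) =
  let E , E∈ , D′≅E = grafted-≅ g r≅l′ in _ , ∈-graftsˡ E∈ , node-iso (inj₂ (l≅r′ , D′≅E))

data MaybeGrafted (m : A) : Maybe (BTree A) → Maybe (BTree A) → Set where
  new  : MaybeGrafted m nothing (just (leaf m))
  just : ∀ {t t′} → Grafted m t t′ → MaybeGrafted m (just t) (just t′)

merge-graftedˡ : ∀ {m : A} {x x′} → MaybeGrafted m x x′ → ∀ y → MaybeGrafted m (merge x y) (merge x′ y)
merge-graftedˡ new      (just _) = just aboveʳ
merge-graftedˡ new      nothing  = new
merge-graftedˡ (just g) (just _) = just (inˡ g)
merge-graftedˡ (just g) nothing  = just g

merge-graftedʳ : ∀ {m : A} {y y′} → MaybeGrafted m y y′ → ∀ x → MaybeGrafted m (merge x y) (merge x y′)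
merge-graftedʳ new      (just _) = just aboveˡ
merge-graftedʳ new      nothing  = new
merge-graftedʳ (just g) (just _) = just (inʳ g)
merge-graftedʳ (just g) nothing  = just g

MaybeGrafted-just⁻ : ∀ {m : A} {y y′ t} → y ≡ just t → MaybeGrafted m y y′ →
                     ∃[ t′ ] (y′ ≡ just t′ × Grafted m t t′)
MaybeGrafted-just⁻ refl (just g) = _ , refl , g

MaybeGrafted-nothing⁻ : ∀ {m : A} {y y′} → y ≡ nothing → MaybeGrafted m y y′ → y′ ≡ just (leaf m)
MaybeGrafted-nothing⁻ refl new = refl

restrict-grafted : ∀ {S : Subset n} {m} → m ∉ S → ∀ t → Unique (leaves t) → m ∈ₗ leaves t →
                   MaybeGrafted m (restrict S t) (restrict (S ∪ ⁅ m ⁆) t)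
restrict-grafted m∉S (leaf _) _ (here refl) =
  subst₂ (MaybeGrafted _) (sym (restrict-leaf-∉ m∉S)) (sym (restrict-leaf-∈ (∈-∪⁅⁆⁺ (inj₂ refl)))) new
restrict-grafted {S = S} {m} m∉S (node l r) u m∈t with Unique-++⁻ (leaves l) u | ∈-++⁻ (leaves l) m∈t
... | u-l , _ , l#r | inj₁ m∈l
  rewrite restrict-node S l r | restrict-node (S ∪ ⁅ m ⁆) l r
        | restrict-∪-fresh S r (λ m∈r → l#r (m∈l , m∈r))
  = merge-graftedˡ (restrict-grafted m∉S l u-l m∈l) (restrict S r)
... | _ , u-r , l#r | inj₂ m∈r
  rewrite restrict-node S l r | restrict-node (S ∪ ⁅ m ⁆) l r
        | restrict-∪-fresh S l (λ m∈l → l#r (m∈l , m∈r))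
  = merge-graftedʳ (restrict-grafted m∉S r u-r m∈r) (restrict S l)

-- Scars on a pendant edge

leaf-at⇒∈ : ∀ (t : BTree A) p {a} → subtree t p ≡ just (leaf a) → a ∈ₗ leaves t
leaf-at⇒∈ (leaf a)   []      refl = here refl
leaf-at⇒∈ (node l r) (↙ ∷ p) at   = ∈-++⁺ˡ (leaf-at⇒∈ l p at)
leaf-at⇒∈ (node l r) (↘ ∷ p) at   = ∈-++⁺ʳ (leaves l) (leaf-at⇒∈ r p at)

∈⇒leaf-at : ∀ (t : BTree A) {a} → a ∈ₗ leaves t → ∃[ p ] subtree t p ≡ just (leaf a)
∈⇒leaf-at (leaf a)   (here refl) = [] , refl
∈⇒leaf-at (node l r) a∈t with ∈-++⁻ (leaves l) a∈t
... | inj₁ a∈l = let p , at = ∈⇒leaf-at l a∈l in ↙ ∷ p , at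
... | inj₂ a∈r = let p , at = ∈⇒leaf-at r a∈r in ↘ ∷ p , at

¬InK⇒disjoint : ∀ (t : BTree (Fin n)) {S} → ¬ InK t S [] → ∀ {a} → a ∈ₗ leaves t → a ∉ S
¬InK⇒disjoint t ¬InK a∈t a∈S = let p , at = ∈⇒leaf-at t a∈t in ¬InK (_ , a∈S , p , at)

∷-Prefix : ∀ d {p q} → Prefix p q → Prefix (d ∷ p) (d ∷ q)
∷-Prefix d (s , refl) = s , refl

∷-StrictPrefix : ∀ d {p q} → StrictPrefix p q → StrictPrefix (d ∷ p) (d ∷ q)
∷-StrictPrefix d (d′ , s , refl) = d′ , s , refl

suppressed-path⇒leaf : ∀ {X : Subset n} {x} → x ∈ X → ∀ t q → subtree t q ≡ just (leaf x) →
                       (∀ p → StrictPrefix p q → Suppressed t X p) → restrict X t ≡ just (leaf x)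
suppressed-path⇒leaf x∈X (leaf _) [] refl _ = restrict-leaf-∈ x∈X
suppressed-path⇒leaf {X = X} {x} x∈X (node l r) (↙ ∷ q) x-at bare with bare [] (↙ , q , refl)
... | inj₁ (_ , ¬InK-r)
  rewrite restrict-node X l r
        | suppressed-path⇒leaf x∈X l q x-at (λ p p≺q → bare (↙ ∷ p) (∷-StrictPrefix ↙ p≺q))
        | restrict-disjoint X r (¬InK⇒disjoint r ¬InK-r) = refl
... | inj₂ (¬InK-l , _) = ⊥-elim (¬InK-l (x , x∈X , q , x-at))
suppressed-path⇒leaf {X = X} {x} x∈X (node l r) (↘ ∷ q) x-at bare with bare [] (↘ , q , refl)
... | inj₂ (¬InK-l , _)
  rewrite restrict-node X l r
        | suppressed-path⇒leaf x∈X r q x-at (λ p p≺q → bare (↘ ∷ p) (∷-StrictPrefix ↘ p≺q))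
        | restrict-disjoint X l (¬InK⇒disjoint l ¬InK-l) = refl
... | inj₁ (_ , ¬InK-r) = ⊥-elim (¬InK-r (x , x∈X , q , x-at))

-- The data of ScarOn t X w q with subtree t q ≡ just (leaf x); a is the vertex called m there,
-- where the path from w first meets T⟦X⟧.

record ScarPath (t : BTree (Fin n)) (X : Subset n) (w x : Fin n) (a : Pos) : Set where
  field
    {pw q}       : Pos
    w-at         : subtree t pw ≡ just (leaf w)
    x-at         : subtree t q ≡ just (leaf x)
    a≼pw         : Prefix a pw
    a≺q          : StrictPrefix a q
    w-side-clear : ∀ p → StrictPrefix a p → Prefix p pw → ¬ InK t X p
    x-side-bare  : ∀ p → Prefix a p → StrictPrefix p q → Suppressed t X p

scarPath : ∀ {t : BTree (Fin n)} {X w x} → ScarOnLeafEdge t X w x → ∃[ a ] ScarPath t X w x a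
scarPath (_ , x-at , _ , _ , a , w-at , a≼pw , _ , clear , a≺q , bare) = a , record
  { w-at = w-at ; x-at = x-at ; a≼pw = a≼pw ; a≺q = a≺q ; w-side-clear = clear ; x-side-bare = bare }

child : Dir → BTree A → BTree A → BTree A
child ↙ l _ = l
child ↘ _ r = r

descend : ∀ {l r : BTree (Fin n)} {X w x} d {a} →
          ScarPath (node l r) X w x (d ∷ a) → ScarPath (child d l r) X w x a
descend ↙ record { w-at = w-at ; x-at = x-at ; a≼pw = s , refl ; a≺q = d , s′ , refl
                 ; w-side-clear = clear ; x-side-bare = bare } = record
  { w-at = w-at ; x-at = x-at ; a≼pw = s , refl ; a≺q = d , s′ , refl
  ; w-side-clear = λ p a≺p p≼pw → clear (↙ ∷ p) (∷-StrictPrefix ↙ a≺p) (∷-Prefix ↙ p≼pw)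
  ; x-side-bare  = λ p a≼p p≺q → bare (↙ ∷ p) (∷-Prefix ↙ a≼p) (∷-StrictPrefix ↙ p≺q) }
descend ↘ record { w-at = w-at ; x-at = x-at ; a≼pw = s , refl ; a≺q = d , s′ , refl
                 ; w-side-clear = clear ; x-side-bare = bare } = record
  { w-at = w-at ; x-at = x-at ; a≼pw = s , refl ; a≺q = d , s′ , refl
  ; w-side-clear = λ p a≺p p≼pw → clear (↘ ∷ p) (∷-StrictPrefix ↘ a≺p) (∷-Prefix ↘ p≼pw)
  ; x-side-bare  = λ p a≼p p≺q → bare (↘ ∷ p) (∷-Prefix ↘ a≼p) (∷-StrictPrefix ↘ p≺q) }

data MaybeGraftedAt (x m : A) : Maybe (BTree A) → Maybe (BTree A) → Set where
  just : ∀ {t t′} → GraftedAt x m t t′ → MaybeGraftedAt x m (just t) (just t′)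

merge-graftedAtˡ : ∀ {x m : A} {y y′} → MaybeGraftedAt x m y y′ → ∀ z →
                   MaybeGraftedAt x m (merge y z) (merge y′ z)
merge-graftedAtˡ (just g) (just _) = just (inˡ g)
merge-graftedAtˡ (just g) nothing  = just g

merge-graftedAtʳ : ∀ {x m : A} {z z′} → MaybeGraftedAt x m z z′ → ∀ y →
                   MaybeGraftedAt x m (merge y z) (merge y z′)
merge-graftedAtʳ (just g) (just _) = just (inʳ g)
merge-graftedAtʳ (just g) nothing  = just g

MaybeGraftedAt-just⁻ : ∀ {x m : A} {y y′ t} → y ≡ just t → MaybeGraftedAt x m y y′ →
                       ∃[ t′ ] (y′ ≡ just t′ × GraftedAt x m t t′)
MaybeGraftedAt-just⁻ refl (just g) = _ , refl , g

module _ {X : Subset n} {w x : Fin n} (x∈X : x ∈ X) (w∉X : w ∉ X) where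

  restrict-cherry : ∀ c {c′} q {pw} → subtree c q ≡ just (leaf x) → subtree c′ pw ≡ just (leaf w) →
                    (∀ p → StrictPrefix p q → Suppressed c X p) → ¬ InK c′ X [] →
                    Unique (leaves c′) → ¬ w ∈ₗ leaves c →
                    restrict X c ≡ just (leaf x) × restrict (X ∪ ⁅ w ⁆) c ≡ just (leaf x)
                    × restrict X c′ ≡ nothing × restrict (X ∪ ⁅ w ⁆) c′ ≡ just (leaf w)
  restrict-cherry c {c′} q {pw} x-at w-at bare clear u-c′ w∉c =
    c∣X , trans (restrict-∪-fresh X c w∉c) c∣X , c′∣X ,
    MaybeGrafted-nothing⁻ c′∣X (restrict-grafted w∉X c′ u-c′ (leaf-at⇒∈ c′ pw w-at))
    where
    c∣X  = suppressed-path⇒leaf x∈X c q x-at bare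
    c′∣X = restrict-disjoint X c′ (¬InK⇒disjoint c′ clear)

  restrict-graftedAt : ∀ t → Unique (leaves t) → ∀ a → ScarPath t X w x a →
                       MaybeGraftedAt x w (restrict X t) (restrict (X ∪ ⁅ w ⁆) t)
  restrict-graftedAt (leaf _) _ []      record { a≺q = _ , _ , refl ; x-at = () }
  restrict-graftedAt (leaf _) _ (_ ∷ _) record { a≺q = _ , _ , refl ; x-at = () }
  restrict-graftedAt (node l r) u (↙ ∷ a) sp with Unique-++⁻ (leaves l) u
  ... | u-l , _ , l#r
    rewrite restrict-node X l r | restrict-node (X ∪ ⁅ w ⁆) l r
          | restrict-∪-fresh X r (λ w∈r → l#r (leaf-at⇒∈ l (ScarPath.pw (descend ↙ sp))
                                                            (ScarPath.w-at (descend ↙ sp)) , w∈r))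
    = merge-graftedAtˡ (restrict-graftedAt l u-l a (descend ↙ sp)) (restrict X r)
  restrict-graftedAt (node l r) u (↘ ∷ a) sp with Unique-++⁻ (leaves l) u
  ... | _ , u-r , l#r
    rewrite restrict-node X l r | restrict-node (X ∪ ⁅ w ⁆) l r
          | restrict-∪-fresh X l (λ w∈l → l#r (w∈l , leaf-at⇒∈ r (ScarPath.pw (descend ↘ sp))
                                                                  (ScarPath.w-at (descend ↘ sp))))
    = merge-graftedAtʳ (restrict-graftedAt r u-r a (descend ↘ sp)) (restrict X l)
  restrict-graftedAt (node l r) u [] record { pw = [] ; w-at = () }
  restrict-graftedAt (node l r) u [] record { pw = d′ ∷ pw ; w-at = w-at ; x-at = x-at ; a≺q = d , q , refl
                                            ; w-side-clear = clear ; x-side-bare = bare }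
    with Unique-++⁻ (leaves l) u | d | d′
  ... | _ | ↙ | ↙ = ⊥-elim (clear [ ↙ ] (↙ , [] , refl) (pw , refl) (x , x∈X , q , x-at))
  ... | _ | ↘ | ↘ = ⊥-elim (clear [ ↘ ] (↘ , [] , refl) (pw , refl) (x , x∈X , q , x-at))
  ... | _ , u-r , l#r | ↙ | ↘
    with restrict-cherry l q {pw} x-at w-at (λ p p≺q → bare (↙ ∷ p) (↙ ∷ p , refl) (∷-StrictPrefix ↙ p≺q))
                         (clear [ ↘ ] (↘ , [] , refl) (pw , refl)) u-r (λ w∈l → l#r (w∈l , leaf-at⇒∈ r pw w-at))
  ... | l∣X , l∣X′ , r∣X , r∣X′
    rewrite restrict-node X l r | restrict-node (X ∪ ⁅ w ⁆) l r | l∣X | l∣X′ | r∣X | r∣X′ = just atˡ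
  restrict-graftedAt (node l r) u [] record { pw = d′ ∷ pw ; w-at = w-at ; x-at = x-at ; a≺q = d , q , refl
                                            ; w-side-clear = clear ; x-side-bare = bare }
    | u-l , _ , l#r | ↘ | ↙
    with restrict-cherry r q {pw} x-at w-at (λ p p≺q → bare (↘ ∷ p) (↘ ∷ p , refl) (∷-StrictPrefix ↘ p≺q))
                         (clear [ ↙ ] (↙ , [] , refl) (pw , refl)) u-l (λ w∈r → l#r (leaf-at⇒∈ l pw w-at , w∈r))
  ... | r∣X , r∣X′ , l∣X , l∣X′
    rewrite restrict-node X l r | restrict-node (X ∪ ⁅ w ⁆) l r | l∣X | l∣X′ | r∣X | r∣X′ = just atʳ

module _ (h : Fin n → Fin k) {t : BTree (Fin n)} (u : Unique (leaves t)) where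

  graftedAt-shape : ∀ {X : Subset n} {x m L E a b} → x ∈ X → m ∉ X → ScarOnLeafEdge t X m x →
                    h x ≡ a → h m ≡ b → restrict X t ≡ just L → mapTree h L ≅ E →
                    ∃[ L′ ] (restrict (X ∪ ⁅ m ⁆) t ≡ just L′
                             × ∃[ F ] (F ∈ₗ graftsAt a b E × mapTree h L′ ≅ F))
  graftedAt-shape x∈X m∉X scar refl refl t∣X≡L hL≅E
    with MaybeGraftedAt-just⁻ t∣X≡L (restrict-graftedAt x∈X m∉X t u _ (proj₂ (scarPath scar)))
  ... | L′ , t∣X′≡L′ , g = L′ , t∣X′≡L′ , graftedAt-≅ (GraftedAt-map h g) hL≅E

  grafted-shape : ∀ {S : Subset n} {m L E b} → m ∉ S → m ∈ₗ leaves t → h m ≡ b →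
                  restrict S t ≡ just L → mapTree h L ≅ E →
                  ∃[ L′ ] (restrict (S ∪ ⁅ m ⁆) t ≡ just L′ × ∃[ F ] (F ∈ₗ grafts b E × mapTree h L′ ≅ F))
  grafted-shape m∉S m∈t refl t∣S≡L hL≅E
    with MaybeGrafted-just⁻ t∣S≡L (restrict-grafted m∉S t u m∈t)
  ... | L′ , t∣S′≡L′ , g = L′ , t∣S′≡L′ , grafted-≅ (Grafted-map h g) hL≅E

  twice-grafted-shape : ∀ {X : Subset n} {x m m′ L E a b b′} → x ∈ X → m ∉ X → m′ ∉ X → m′ ≢ m →
                        m′ ∈ₗ leaves t → ScarOnLeafEdge t X m x → h x ≡ a → h m ≡ b → h m′ ≡ b′ →
                        restrict X t ≡ just L → mapTree h L ≅ E →
                        ∃[ L′ ] (restrict ((X ∪ ⁅ m ⁆) ∪ ⁅ m′ ⁆) t ≡ just L′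
                                 × ∃[ F ] (F ∈ₗ concatMap (grafts b′) (graftsAt a b E) × mapTree h L′ ≅ F))
  twice-grafted-shape x∈X m∉X m′∉X m′≢m m′∈t scar hx hm hm′ t∣X≡L hL≅E
    with graftedAt-shape x∈X m∉X scar hx hm t∣X≡L hL≅E
  ... | L₁ , t∣X₁≡L₁ , E₁ , E₁∈ , hL₁≅E₁
    with grafted-shape (∉-∪⁅⁆ m′∉X m′≢m) m′∈t hm′ t∣X₁≡L₁ hL₁≅E₁
  ... | L₂ , t∣X₂≡L₂ , F , F∈ , hL₂≅F = L₂ , t∣X₂≡L₂ , F , ∈-concatMap⁺ (grafts _) (lose E₁∈ F∈) , hL₂≅F

-- The finite check

restrictIso? : ∀ (Y : Subset n) (g : Fin n → Fin k) t K → Dec (RestrictIso Y g t K)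
restrictIso? Y g t K = AnyM.dec (λ E → treeIso? g E K) (restrict Y t)

crossResponsibleVia? : ∀ (D D′ : BTree (Fin n)) Y g → Dec (CrossResponsibleVia D D′ Y g)
crossResponsibleVia? D D′ Y g =
  (restrictIso? Y g D K1-left ×-dec restrictIso? Y g D′ K1-right) ⊎-dec
  (restrictIso? Y g D K2-left ×-dec restrictIso? Y g D′ K2-right)

-- Labels in Fin 7: 0 = u₂, 1 = x, 2 = y, 3 = u₁ (the matching edges of K₂, numbered as in Defs),
-- 4 = m₁, 5 = m₂, and 6 for every other matching edge.

K2-left₇ K2-right₇ : BTree (Fin 7)
K2-left₇  = mapTree (_↑ˡ 3) K2-left
K2-right₇ = mapTree (_↑ˡ 3) K2-right

leftShapes rightShapes leftShapes₁ rightShapes₁ : List (BTree (Fin 7))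
leftShapes   = concatMap (grafts (# 5)) (graftsAt (# 1) (# 4) K2-left₇)
rightShapes  = concatMap (grafts (# 4)) (graftsAt (# 1) (# 5) K2-right₇)
leftShapes₁  = graftsAt (# 1) (# 4) K2-left₇
rightShapes₁ = graftsAt (# 1) (# 4) K2-right₇

-- A certificate sends each label of a cross-responsible set to the matching edge of K₁ or K₂
-- it corresponds to; the certificates below were found by exhaustive search.

Certificate : Set
Certificate = Vec (Maybe (Fin 4)) 7

support : Certificate → Subset 7
support = Vec.map is-just

-- zero is a junk value off the support, never seen after restricting to the support.
image : Certificate → Fin 7 → Fin 4
image c b = fromMaybe zero (lookup c b)

Certifies : (Subset 7 → Set) → BTree (Fin 7) → BTree (Fin 7) → Certificate → Set
Certifies Marked D D′ c =
  Marked (support c) × support c ⊆ ∁ ⁅ # 6 ⁆ × CrossResponsibleVia D D′ (support c) (image c)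

certifies? : ∀ {Marked} → (∀ S → Dec (Marked S)) → ∀ D D′ c → Dec (Certifies Marked D D′ c)
certifies? marked? D D′ c =
  marked? (support c) ×-dec (support c ⊆? ∁ ⁅ # 6 ⁆) ×-dec crossResponsibleVia? D D′ (support c) (image c)

MeetsScars : Subset 7 → Set
MeetsScars S = # 4 ∈ S ⊎ # 5 ∈ S

distinctCertificates : List Certificate
distinctCertificates =
    (just (# 0) ∷ nothing    ∷ just (# 2) ∷ just (# 3) ∷ just (# 1) ∷ nothing    ∷ nothing ∷ [])
  ∷ (nothing    ∷ just (# 0) ∷ just (# 2) ∷ just (# 3) ∷ just (# 1) ∷ nothing    ∷ nothing ∷ [])
  ∷ (just (# 0) ∷ nothing    ∷ just (# 2) ∷ just (# 3) ∷ nothing    ∷ just (# 1) ∷ nothing ∷ [])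
  ∷ (just (# 0) ∷ just (# 2) ∷ nothing    ∷ just (# 1) ∷ just (# 3) ∷ nothing    ∷ nothing ∷ [])
  ∷ (just (# 1) ∷ just (# 2) ∷ nothing    ∷ just (# 3) ∷ nothing    ∷ just (# 0) ∷ nothing ∷ [])
  ∷ (nothing    ∷ just (# 0) ∷ just (# 3) ∷ nothing    ∷ just (# 1) ∷ just (# 2) ∷ nothing ∷ [])
  ∷ (just (# 0) ∷ just (# 3) ∷ just (# 2) ∷ nothing    ∷ nothing    ∷ just (# 1) ∷ nothing ∷ [])
  ∷ []

sharedCertificate : Certificate
sharedCertificate = just (# 0) ∷ nothing ∷ just (# 2) ∷ just (# 3) ∷ just (# 1) ∷ nothing ∷ nothing ∷ []

-- abstract: unfolding these evaluated tables at their use sites is very slow.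
abstract
  distinct-certified : ∀ {D D′} → D ∈ₗ leftShapes → D′ ∈ₗ rightShapes → ∃ (Certifies MeetsScars D D′)
  distinct-certified D∈ D′∈ = satisfied (All.lookup (All.lookup table D∈) D′∈)
    where
    table : All (λ D → All (λ D′ → Any (Certifies MeetsScars D D′) distinctCertificates) rightShapes)
                leftShapes
    table = toWitness {a? = all? (λ D → all? (λ D′ → any? (certifies? (λ S → # 4 ∈? S ⊎-dec # 5 ∈? S) D D′)
                                                           distinctCertificates)
                                             rightShapes)
                                 leftShapes} _

  shared-certified : ∀ {D D′} → D ∈ₗ leftShapes₁ → D′ ∈ₗ rightShapes₁ →
                     Certifies (# 4 ∈_) D D′ sharedCertificate
  shared-certified D∈ D′∈ = All.lookup (All.lookup table D∈) D′∈
    where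
    table : All (λ D → All (λ D′ → Certifies (# 4 ∈_) D D′ sharedCertificate) rightShapes₁) leftShapes₁
    table = toWitness {a? = all? (λ D → all? (λ D′ → certifies? (# 4 ∈?_) D D′ sharedCertificate)
                                             rightShapes₁)
                                 leftShapes₁} _

module Relabel (X : Subset n) (f : Fin n → Fin 4) (m₁ m₂ : Fin n) where

  relabel : Fin n → Fin 7
  relabel a with a ∈? X | a ≟ m₁ | a ≟ m₂
  ... | yes _ | _     | _     = f a ↑ˡ 3
  ... | no _  | yes _ | _     = # 4
  ... | no _  | no _  | yes _ = # 5
  ... | no _  | no _  | no _  = # 6

  relabel-∈ : ∀ {a} → a ∈ X → relabel a ≡ f a ↑ˡ 3
  relabel-∈ {a} a∈X with a ∈? X
  ... | yes _  = refl
  ... | no a∉X = ⊥-elim (a∉X a∈X)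

  relabel-m₁ : m₁ ∉ X → relabel m₁ ≡ # 4
  relabel-m₁ m₁∉X with m₁ ∈? X | m₁ ≟ m₁
  ... | yes m₁∈X | _        = ⊥-elim (m₁∉X m₁∈X)
  ... | no _     | yes _    = refl
  ... | no _     | no m₁≢m₁ = ⊥-elim (m₁≢m₁ refl)

  relabel-m₂ : m₂ ∉ X → m₂ ≢ m₁ → relabel m₂ ≡ # 5
  relabel-m₂ m₂∉X m₂≢m₁ with m₂ ∈? X | m₂ ≟ m₁ | m₂ ≟ m₂
  ... | yes m₂∈X | _         | _        = ⊥-elim (m₂∉X m₂∈X)
  ... | no _     | yes m₂≡m₁ | _        = ⊥-elim (m₂≢m₁ m₂≡m₁)
  ... | no _     | no _      | yes _    = refl
  ... | no _     | no _      | no m₂≢m₂ = ⊥-elim (m₂≢m₂ refl)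

  relabel⁻¹-⊆ : ∀ {S} → S ⊆ ∁ ⁅ # 6 ⁆ → ∀ {a} → a ∈ relabel ⁻¹ S → a ∈ X ⊎ a ≡ m₁ ⊎ a ≡ m₂
  relabel⁻¹-⊆ S⊆ {a} a∈ with a ∈? X | a ≟ m₁ | a ≟ m₂ | x∈∁p⇒x∉p (S⊆ (∈-⁻¹⁻ relabel a∈))
  ... | yes a∈X | _        | _        | _      = inj₁ a∈X
  ... | no _    | yes a≡m₁ | _        | _      = inj₂ (inj₁ a≡m₁)
  ... | no _    | no _     | yes a≡m₂ | _      = inj₂ (inj₂ a≡m₂)
  ... | no _    | no _     | no _     | 6∉⁅6⁆ = ⊥-elim (6∉⁅6⁆ (x∈⁅x⁆ _))

module _ (T : Tanglegram n) {X : Subset n} {f : Fin n → Fin 4} {L R : BTree (Fin n)}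
         (T∣X≡L : restrict X (left T) ≡ just L) (T∣X≡R : restrict X (right T) ≡ just R)
         (L≅K2 : TreeIso f L K2-left) (R≅K2 : TreeIso f R K2-right)
         {x : Fin n} (x∈X : x ∈ X) (fx≡x : f x ≡ K2-x) where

  private
    uₗ : Unique (leaves (left T))
    uₗ = unique-leaves (left T) (left-perm T)

    uᵣ : Unique (leaves (right T))
    uᵣ = unique-leaves (right T) (right-perm T)

    module Labels (m₁ m₂ : Fin n) where
      open Relabel X f m₁ m₂ public

      relabel-x : relabel x ≡ # 1
      relabel-x = trans (relabel-∈ x∈X) (cong (_↑ˡ 3) fx≡x)

      relabel-L : mapTree relabel L ≅ K2-left₇
      relabel-L = mapTree-≅ relabel (_↑ˡ 3) L≅K2 (relabel-∈ ∘ ∈-restrict X (left T) T∣X≡L)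

      relabel-R : mapTree relabel R ≅ K2-right₇
      relabel-R = mapTree-≅ relabel (_↑ˡ 3) R≅K2 (relabel-∈ ∘ ∈-restrict X (right T) T∣X≡R)

  distinct-scars⇒crossResponsible :
    ∀ {m₁ m₂} → m₁ ∉ X → m₂ ∉ X → m₂ ≢ m₁ →
    ScarOnLeafEdge (left T) X m₁ x → ScarOnLeafEdge (right T) X m₂ x →
    ∃[ Y ] (CrossResponsible T Y × (m₁ ∈ Y ⊎ m₂ ∈ Y))
  distinct-scars⇒crossResponsible {m₁} {m₂} m₁∉X m₂∉X m₂≢m₁ scarₗ scarᵣ
    with twice-grafted-shape relabel uₗ x∈X m₁∉X m₂∉X m₂≢m₁ (∈-leaves (left T) (left-perm T) m₂) scarₗ
                             relabel-x (relabel-m₁ m₁∉X) (relabel-m₂ m₂∉X m₂≢m₁) T∣X≡L relabel-L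
       | twice-grafted-shape relabel uᵣ x∈X m₂∉X m₁∉X (m₂≢m₁ ∘ sym) (∈-leaves (right T) (right-perm T) m₁) scarᵣ
                             relabel-x (relabel-m₂ m₂∉X m₂≢m₁) (relabel-m₁ m₁∉X) T∣X≡R relabel-R
    where open Labels m₁ m₂
  ... | L′ , T∣Xₗ≡L′ , D , D∈ , L′≅D | R′ , T∣Xᵣ≡R′ , D′ , D′∈ , R′≅D′
    with distinct-certified D∈ D′∈
  ... | c , meets , support⊆ , responsible =
    relabel ⁻¹ support c ,
    crossResponsible-pullback T relabel T∣Xₗ≡L′ T∣Xᵣ≡R′
      (∈Xₗ ∘ relabel⁻¹-⊆ support⊆) (∈Xᵣ ∘ relabel⁻¹-⊆ support⊆) L′≅D R′≅D′ responsible ,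
    scars∈ meets
    where
    open Labels m₁ m₂
    ∈Xₗ : ∀ {a} → a ∈ X ⊎ a ≡ m₁ ⊎ a ≡ m₂ → a ∈ (X ∪ ⁅ m₁ ⁆) ∪ ⁅ m₂ ⁆
    ∈Xₗ (inj₁ a∈X)         = ∈-∪⁅⁆⁺ (inj₁ (∈-∪⁅⁆⁺ (inj₁ a∈X)))
    ∈Xₗ (inj₂ (inj₁ a≡m₁)) = ∈-∪⁅⁆⁺ (inj₁ (∈-∪⁅⁆⁺ (inj₂ a≡m₁)))
    ∈Xₗ (inj₂ (inj₂ a≡m₂)) = ∈-∪⁅⁆⁺ (inj₂ a≡m₂)
    ∈Xᵣ : ∀ {a} → a ∈ X ⊎ a ≡ m₁ ⊎ a ≡ m₂ → a ∈ (X ∪ ⁅ m₂ ⁆) ∪ ⁅ m₁ ⁆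
    ∈Xᵣ (inj₁ a∈X)         = ∈-∪⁅⁆⁺ (inj₁ (∈-∪⁅⁆⁺ (inj₁ a∈X)))
    ∈Xᵣ (inj₂ (inj₁ a≡m₁)) = ∈-∪⁅⁆⁺ (inj₂ a≡m₁)
    ∈Xᵣ (inj₂ (inj₂ a≡m₂)) = ∈-∪⁅⁆⁺ (inj₁ (∈-∪⁅⁆⁺ (inj₂ a≡m₂)))
    scars∈ : MeetsScars (support c) → m₁ ∈ relabel ⁻¹ support c ⊎ m₂ ∈ relabel ⁻¹ support c
    scars∈ (inj₁ 4∈) = inj₁ (∈-⁻¹⁺ relabel (subst (_∈ support c) (sym (relabel-m₁ m₁∉X)) 4∈))
    scars∈ (inj₂ 5∈) = inj₂ (∈-⁻¹⁺ relabel (subst (_∈ support c) (sym (relabel-m₂ m₂∉X m₂≢m₁)) 5∈))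

  shared-scar⇒crossResponsible :
    ∀ {m} → m ∉ X → ScarOnLeafEdge (left T) X m x → ScarOnLeafEdge (right T) X m x →
    ∃[ Y ] (CrossResponsible T Y × m ∈ Y)
  shared-scar⇒crossResponsible {m} m∉X scarₗ scarᵣ
    with graftedAt-shape relabel uₗ x∈X m∉X scarₗ relabel-x (relabel-m₁ m∉X) T∣X≡L relabel-L
       | graftedAt-shape relabel uᵣ x∈X m∉X scarᵣ relabel-x (relabel-m₁ m∉X) T∣X≡R relabel-R
    where open Labels m m
  ... | L′ , T∣X′≡L′ , D , D∈ , L′≅D | R′ , T∣X′≡R′ , D′ , D′∈ , R′≅D′
    with shared-certified D∈ D′∈
  ... | 4∈ , support⊆ , responsible =
    relabel ⁻¹ support sharedCertificate ,
    crossResponsible-pullback T relabel T∣X′≡L′ T∣X′≡R′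
      (∈X′ ∘ relabel⁻¹-⊆ support⊆) (∈X′ ∘ relabel⁻¹-⊆ support⊆) L′≅D R′≅D′ responsible ,
    ∈-⁻¹⁺ relabel (subst (_∈ support sharedCertificate) (sym (relabel-m₁ m∉X)) 4∈)
    where
    open Labels m m
    ∈X′ : ∀ {a} → a ∈ X ⊎ a ≡ m ⊎ a ≡ m → a ∈ X ∪ ⁅ m ⁆
    ∈X′ (inj₁ a∈X)        = ∈-∪⁅⁆⁺ (inj₁ a∈X)
    ∈X′ (inj₂ (inj₁ a≡m)) = ∈-∪⁅⁆⁺ (inj₂ a≡m)
    ∈X′ (inj₂ (inj₂ a≡m)) = ∈-∪⁅⁆⁺ (inj₂ a≡m)

lemma8 : ∀ {n : ℕ} (T : Tanglegram n) (X : Subset n) →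
    CrossResponsible T X →
    (∀ (Y : Subset n) → CrossResponsible T Y → Y ≡ X) →
    ∀ (f : Fin n → Fin 4) → SubIsoVia T X K2-left K2-right f →
    ∀ (x : Fin n) → x ∈ X → f x ≡ K2-x →
    ¬ ((∃[ m ] (m ∉ X × ScarOnLeafEdge (left T) X m x))
       × (∃[ m ] (m ∉ X × ScarOnLeafEdge (right T) X m x)))
lemma8 T X _ unique f (L , R , T∣X≡L , T∣X≡R , L≅K2 , R≅K2) x x∈X fx≡x
       ((m₁ , m₁∉X , scarₗ) , (m₂ , m₂∉X , scarᵣ)) with m₂ ≟ m₁
... | no m₂≢m₁ =
  let Y , responsible , m∈Y = distinct-scars⇒crossResponsible T T∣X≡L T∣X≡R L≅K2 R≅K2 x∈X fx≡x
                                m₁∉X m₂∉X m₂≢m₁ scarₗ scarᵣ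
      Y≡X = unique Y responsible
  in case m∈Y of λ { (inj₁ m₁∈Y) → m₁∉X (subst (m₁ ∈_) Y≡X m₁∈Y)
                   ; (inj₂ m₂∈Y) → m₂∉X (subst (m₂ ∈_) Y≡X m₂∈Y) }
... | yes refl =
  let Y , responsible , m∈Y = shared-scar⇒crossResponsible T T∣X≡L T∣X≡R L≅K2 R≅K2 x∈X fx≡x
                                m₁∉X scarₗ scarᵣ
  in m₁∉X (subst (m₁ ∈_) (unique Y responsible) m∈Y)
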